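{- For each integer $k\geq 1$, there exists a connected graph $G$ on $n=8k+1$ vertices with $\gamma^{\mathrm{ID}}(G)=5k=\frac{5(n-1)}{8}$.
   Context: All graphs are finite, simple and undirected. $N[v]$ denotes the closed neighbourhood of $v$. A set $C\subseteq V(G)$ is an identifying code if for every vertex $v$ the set $N[v]\cap C$ is nonempty and for every two distinct vertices $u,v$ we have $N[u]\cap C\neq N[v]\cap C$. $\gamma^{\mathrm{ID}}(G)$ is the minimum size of an identifying code of $G$. -}

module Defs where

open import Data.Nat using (ℕ; _≤_)
open import Data.Bool using (Bool; true; false; _∨_)
open import Data.Fin using (Fin; _≟_)
open import Data.Fin.Subset using (Subset; _∩_; Nonempty; ∣_∣)
open import Data.Vec using (tabulate)
open import Data.Product using (Σ; _×_)
open import Relation.Nullary using (does; ¬_)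
open import Relation.Binary.PropositionalEquality using (_≡_; _≢_)

record Graph (n : ℕ) : Set where
  field
    adj     : Fin n → Fin n → Bool
    adj-sym : ∀ u v → adj u v ≡ adj v u
    adj-irr : ∀ v → adj v v ≡ false
open Graph public

N[_]_ : ∀ {n} → Fin n → Graph n → Subset n
N[ v ] G = tabulate (λ u → does (u Data.Fin.≟ v) ∨ adj G v u)

IsIdentifyingCode : ∀ {n} → Graph n → Subset n → Set
IsIdentifyingCode {n} G C =
  (∀ (v : Fin n) → Nonempty ((N[ v ] G) ∩ C)) ×
  (∀ (u v : Fin n) → u ≢ v → (N[ u ] G) ∩ C ≢ (N[ v ] G) ∩ C)

IdCodeNumber : ∀ {n} → Graph n → ℕ → Set
IdCodeNumber G m =
  Σ (Subset _) (λ C → IsIdentifyingCode G C × ∣ C ∣ ≡ m) ×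
  (∀ C → IsIdentifyingCode G C → m ≤ ∣ C ∣)

data Reachable {n} (G : Graph n) : Fin n → Fin n → Set where
  here  : ∀ {v} → Reachable G v v
  there : ∀ {u w v} → adj G u w ≡ true → Reachable G w v → Reachable G u v

Connected : ∀ {n} → Graph n → Set
Connected {n} G = ∀ (u v : Fin n) → Reachable G u v

-- The graph is k copies of the tree T with edges 0–1, 0–2, 0–3, 1–4, 2–5, 3–6, 3–7, whose roots 0
-- are all joined to one hub. Apart from the roots, no vertex of a copy sees the hub or another copy,
-- so an identifying code restricted to a copy still dominates and separates the non-root vertices
-- of T. That alone costs 5 code vertices per copy: the root (to separate 1 from its pendant
-- neighbour 4), a vertex of {1, 4} and of {2, 5} (to dominate 4 and 5), and two of {3, 6, 7} (to
-- dominate and separate the twin leaves 6 and 7). Conversely, taking {0, 1, 2, 3, 6} in every copy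
-- works: it identifies T, and every vertex of T has a code neighbour other than the root, which
-- tells copies apart from each other and from the hub.
module Submission where

open import Defs
open import Data.Bool using (Bool; true; false; _∨_; _∧_)
open import Data.Bool.Properties using (∨-comm; ∧-zeroʳ; ∧-conicalʳ; ¬-not) renaming (_≟_ to _≟ᵇ_)
open import Data.Empty using (⊥-elim)
open import Data.Fin using (Fin; zero; suc; _↑ˡ_; _↑ʳ_; splitAt; join; combine; remQuot; _≟_)
open import Data.Fin.Patterns using (0F; 1F; 2F; 3F; 4F; 5F; 6F; 7F)
open import Data.Fin.Properties using (all?; any?; splitAt-↑ˡ; splitAt-↑ʳ; join-splitAt; combine-remQuot; remQuot-combine)
open import Data.Fin.Subset using (Subset; _∩_; Nonempty; ∣_∣; _∈_; _∉_; inside; outside)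
open import Data.Fin.Subset.Properties using (_∈?_; ∉⊥; x∈p∩q⁺; x∈p∩q⁻)
open import Data.Nat using (ℕ; zero; suc; _+_; _*_; _≤_; z≤n; s≤s)
open import Data.Nat.Properties using (+-0-commutativeMonoid; +-assoc; +-identityʳ; *-comm; +-mono-≤; m≤m+n; ≤-reflexive; module ≤-Reasoning)
open import Data.Nat.Solver using (module +-*-Solver)
open import Data.Product using (Σ; ∃-syntax; _×_; _,_; proj₁; proj₂; uncurry)
open import Data.Sum using (inj₁; inj₂)
open import Data.Vec using ([]; _∷_; lookup; tabulate)
open import Data.Vec.Properties using (≡-dec; lookup∘tabulate; tabulate∘lookup; tabulate-cong; lookup-zipWith; lookup⇒[]=; []=⇒lookup)
open import Function using (_∘_)
open import Relation.Nullary using (Dec; does; yes; no; ¬?; _×-dec_)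
open import Relation.Nullary.Decidable using (dec-true; dec-false; toWitness; _→-dec_)
open import Relation.Binary.PropositionalEquality using (_≡_; _≢_; refl; sym; trans; cong; cong₂; subst; module ≡-Reasoning)
open import Algebra.Properties.CommutativeMonoid.Sum +-0-commutativeMonoid using (sum-syntax; ∑-comm; sum-cong-≗)

does-≟-sym : ∀ {n} (i j : Fin n) → does (i ≟ j) ≡ does (j ≟ i)
does-≟-sym i j with i ≟ j
... | yes refl = sym (dec-true (i ≟ i) refl)
... | no i≢j   = sym (dec-false (j ≟ i) (i≢j ∘ sym))

true≢false : true ≢ false
true≢false ()

lookup-ext : ∀ {n} {p q : Subset n} → (∀ i → lookup p i ≡ lookup q i) → p ≡ q
lookup-ext {p = p} {q} h = trans (sym (tabulate∘lookup p)) (trans (tabulate-cong h) (tabulate∘lookup q))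

lookup-∩ : ∀ {n} (p q : Subset n) i → lookup (p ∩ q) i ≡ lookup p i ∧ lookup q i
lookup-∩ p q i = lookup-zipWith _∧_ i p q

Separates : ∀ {n} → Graph n → Subset n → Set
Separates G C = ∀ u v → u ≢ v → N[ u ] G ∩ C ≢ N[ v ] G ∩ C

DominatesWithout : ∀ {n} → Graph n → Fin n → Subset n → Set
DominatesWithout G r C = ∀ v → ∃[ w ] w ≢ r × w ∈ N[ v ] G ∩ C

IdentifiesAllBut : ∀ {n} → Graph n → Fin n → Subset n → Set
IdentifiesAllBut G r C =
  (∀ v → v ≢ r → Nonempty (N[ v ] G ∩ C)) ×
  (∀ u v → u ≢ r → v ≢ r → u ≢ v → N[ u ] G ∩ C ≢ N[ v ] G ∩ C)

separates? : ∀ {n} (G : Graph n) C → Dec (Separates G C)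
separates? G C = all? λ u → all? λ v →
  ¬? (u ≟ v) →-dec ¬? (≡-dec _≟ᵇ_ (N[ u ] G ∩ C) (N[ v ] G ∩ C))

dominatesWithout? : ∀ {n} (G : Graph n) r C → Dec (DominatesWithout G r C)
dominatesWithout? G r C = all? λ v → any? λ w → ¬? (w ≟ r) ×-dec (w ∈? N[ v ] G ∩ C)

module _ {n} {G : Graph n} where

  Reachable-trans : ∀ {u v w} → Reachable G u v → Reachable G v w → Reachable G u w
  Reachable-trans here        q = q
  Reachable-trans (there e p) q = there e (Reachable-trans p q)

  Reachable-sym : ∀ {u v} → Reachable G u v → Reachable G v u
  Reachable-sym here = here
  Reachable-sym (there {u} {w} e p) =
    Reachable-trans (Reachable-sym p) (there (trans (adj-sym G w u) e) here)

  connected-if-all-reach : ∀ h → (∀ v → Reachable G v h) → Connected G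
  connected-if-all-reach h reach u v = Reachable-trans (reach u) (Reachable-sym (reach v))

bit : Bool → ℕ
bit true  = 1
bit false = 0

∣p∣≡∑bit : ∀ {n} (p : Subset n) → ∣ p ∣ ≡ ∑[ i < n ] bit (lookup p i)
∣p∣≡∑bit []            = refl
∣p∣≡∑bit (inside  ∷ p) = cong suc (∣p∣≡∑bit p)
∣p∣≡∑bit (outside ∷ p) = ∣p∣≡∑bit p

∑-splitAt : ∀ m {n} (f : Fin (m + n) → ℕ) →
            ∑[ i < m + n ] f i ≡ ∑[ i < m ] f (i ↑ˡ n) + ∑[ i < n ] f (m ↑ʳ i)
∑-splitAt zero    f = refl
∑-splitAt (suc m) f = trans (cong (f zero +_) (∑-splitAt m (f ∘ suc))) (sym (+-assoc (f zero) _ _))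

∑-combine : ∀ m {n} (f : Fin (m * n) → ℕ) →
            ∑[ i < m * n ] f i ≡ ∑[ p < m ] ∑[ j < n ] f (combine p j)
∑-combine zero    f = refl
∑-combine (suc m) {n} f =
  trans (∑-splitAt n f) (cong (∑[ j < n ] f (j ↑ˡ m * n) +_) (∑-combine m (f ∘ (n ↑ʳ_))))

∑-mono-≤ : ∀ {n} {f g : Fin n → ℕ} → (∀ i → f i ≤ g i) → ∑[ i < n ] f i ≤ ∑[ i < n ] g i
∑-mono-≤ {zero}  f≤g = z≤n
∑-mono-≤ {suc n} f≤g = +-mono-≤ (f≤g zero) (∑-mono-≤ (f≤g ∘ suc))

∑-const : ∀ n c → ∑[ i < n ] c ≡ n * c
∑-const zero    c = refl
∑-const (suc n) c = cong (c +_) (∑-const n c)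

1≤bit+bit : ∀ a b → a ∨ b ≡ true → 1 ≤ bit a + bit b
1≤bit+bit true  _     _ = s≤s z≤n
1≤bit+bit false true  _ = s≤s z≤n

2≤bit+bit+bit : ∀ a b c → a ∨ b ≡ true → a ∨ c ≡ true → b ∨ c ≡ true → 2 ≤ bit a + bit b + bit c
2≤bit+bit+bit true  true  _     _ _ _ = s≤s (s≤s z≤n)
2≤bit+bit+bit true  false true  _ _ _ = s≤s (s≤s z≤n)
2≤bit+bit+bit false true  true  _ _ _ = s≤s (s≤s z≤n)

module HubOfCopies {m} (H : Graph m) (root : Fin m) (k : ℕ) where

  data Vertex : Set where
    copy : Fin m → Fin k → Vertex
    hub  : Vertex

  index : Vertex → Fin (m * k + 1)
  index (copy p j) = combine p j ↑ˡ 1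
  index hub        = m * k ↑ʳ 0F

  vertex : Fin (m * k + 1) → Vertex
  vertex i with splitAt (m * k) i
  ... | inj₁ c = uncurry copy (remQuot k c)
  ... | inj₂ _ = hub

  vertex-index : ∀ x → vertex (index x) ≡ x
  vertex-index (copy p j) rewrite splitAt-↑ˡ (m * k) (combine p j) 1 = cong (uncurry copy) (remQuot-combine p j)
  vertex-index hub        rewrite splitAt-↑ʳ (m * k) 1 0F = refl

  index-vertex : ∀ i → index (vertex i) ≡ i
  index-vertex i with splitAt (m * k) i in eq
  ... | inj₁ c  = trans (cong (_↑ˡ 1) (combine-remQuot {m} k c))
                        (trans (cong (join (m * k) 1) (sym eq)) (join-splitAt (m * k) 1 i))
  ... | inj₂ 0F = trans (cong (join (m * k) 1) (sym eq)) (join-splitAt (m * k) 1 i)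

  index-injective : ∀ x y → index x ≡ index y → x ≡ y
  index-injective x y e = trans (sym (vertex-index x)) (trans (cong vertex e) (vertex-index y))

  copy-injective : ∀ {p q i j} → copy p i ≡ copy q j → p ≡ q × i ≡ j
  copy-injective refl = refl , refl

  hub≢copy : ∀ {p j} → hub ≢ copy p j
  hub≢copy ()

  via-index : ∀ {ℓ} {P : Fin (m * k + 1) → Set ℓ} → (∀ x → P (index x)) → ∀ i → P i
  via-index {P = P} h i = subst P (index-vertex i) (h (vertex i))

  _~_ : Vertex → Vertex → Bool
  copy p i ~ copy q j = does (i ≟ j) ∧ adj H p q
  copy p _ ~ hub      = does (p ≟ root)
  hub      ~ copy q _ = does (q ≟ root)
  hub      ~ hub      = false

  ~-sym : ∀ x y → x ~ y ≡ y ~ x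
  ~-sym (copy p i) (copy q j) = cong₂ _∧_ (does-≟-sym i j) (adj-sym H p q)
  ~-sym (copy p i) hub        = refl
  ~-sym hub        (copy q j) = refl
  ~-sym hub        hub        = refl

  ~-irr : ∀ x → x ~ x ≡ false
  ~-irr (copy p j) = trans (cong (does (j ≟ j) ∧_) (adj-irr H p)) (∧-zeroʳ _)
  ~-irr hub        = refl

  hubOfCopies : Graph (m * k + 1)
  hubOfCopies = record
    { adj     = λ u v → vertex u ~ vertex v
    ; adj-sym = λ u v → ~-sym (vertex u) (vertex v)
    ; adj-irr = λ v → ~-irr (vertex v)
    }

  private
    G = hubOfCopies

  adj-index : ∀ x y → adj G (index x) (index y) ≡ x ~ y
  adj-index x y = cong₂ _~_ (vertex-index x) (vertex-index y)

  walk-in-copy : ∀ j {p q} → Reachable H p q → Reachable G (index (copy p j)) (index (copy q j))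
  walk-in-copy j here = here
  walk-in-copy j (there {u = p} {w = w} e r) =
    there (trans (adj-index (copy p j) (copy w j)) (trans (cong (_∧ adj H p w) (dec-true (j ≟ j) refl)) e))
          (walk-in-copy j r)

  hubOfCopies-connected : Connected H → Connected hubOfCopies
  hubOfCopies-connected conn = connected-if-all-reach (index hub) (via-index reach-hub)
    where
    reach-hub : ∀ x → Reachable G (index x) (index hub)
    reach-hub (copy p j) = Reachable-trans (walk-in-copy j (conn p root))
      (there (trans (adj-index (copy root j) hub) (dec-true (root ≟ root) refl)) here)
    reach-hub hub = here

  N-index : ∀ x y → lookup (N[ index x ] G) (index y) ≡ does (index y ≟ index x) ∨ (x ~ y)
  N-index x y = trans (lookup∘tabulate _ (index y)) (cong (does (index y ≟ index x) ∨_) (adj-index x y))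

  N-same-copy : ∀ p q j → lookup (N[ index (copy p j) ] G) (index (copy q j)) ≡ lookup (N[ p ] H) q
  N-same-copy p q j = begin
    lookup (N[ index (copy p j) ] G) (index (copy q j))
      ≡⟨ N-index (copy p j) (copy q j) ⟩
    does (index (copy q j) ≟ index (copy p j)) ∨ (does (j ≟ j) ∧ adj H p q)
      ≡⟨ cong₂ _∨_ index-≟ (cong (_∧ adj H p q) (dec-true (j ≟ j) refl)) ⟩
    does (q ≟ p) ∨ adj H p q
      ≡⟨ lookup∘tabulate _ q ⟨
    lookup (N[ p ] H) q ∎
    where
    open ≡-Reasoning
    index-≟ : does (index (copy q j) ≟ index (copy p j)) ≡ does (q ≟ p)
    index-≟ with q ≟ p
    ... | yes refl = dec-true (index (copy q j) ≟ index (copy q j)) refl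
    ... | no q≢p   = dec-false (index (copy q j) ≟ index (copy p j))
                       (q≢p ∘ proj₁ ∘ copy-injective ∘ index-injective (copy q j) (copy p j))

  N-other-copy : ∀ p q {i j} → i ≢ j → lookup (N[ index (copy p i) ] G) (index (copy q j)) ≡ false
  N-other-copy p q {i} {j} i≢j = trans (N-index (copy p i) (copy q j)) (cong₂ _∨_
    (dec-false (index (copy q j) ≟ index (copy p i))
               (i≢j ∘ sym ∘ proj₂ ∘ copy-injective ∘ index-injective (copy q j) (copy p i)))
    (cong (_∧ adj H p q) (dec-false (i ≟ j) i≢j)))

  N-copy-hub : ∀ p j → lookup (N[ index (copy p j) ] G) (index hub) ≡ does (p ≟ root)
  N-copy-hub p j = trans (N-index (copy p j) hub)
    (cong (_∨ does (p ≟ root)) (dec-false (index hub ≟ index (copy p j)) (hub≢copy ∘ index-injective hub (copy p j))))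

  N-hub-copy : ∀ q j → lookup (N[ index hub ] G) (index (copy q j)) ≡ does (q ≟ root)
  N-hub-copy q j = trans (N-index hub (copy q j))
    (cong (_∨ does (q ≟ root)) (dec-false (index (copy q j) ≟ index hub) (hub≢copy ∘ sym ∘ index-injective (copy q j) hub)))

  tabulateᵥ : (Vertex → Bool) → Subset (m * k + 1)
  tabulateᵥ f = tabulate (f ∘ vertex)

  lookup-tabulateᵥ : ∀ f x → lookup (tabulateᵥ f) (index x) ≡ f x
  lookup-tabulateᵥ f x = trans (lookup∘tabulate _ (index x)) (cong f (vertex-index x))

  _↾_ : Subset (m * k + 1) → Fin k → Subset m
  C ↾ j = tabulate λ p → lookup C (index (copy p j))

  inCopy : Fin k → Subset m → Vertex → Bool
  inCopy j S (copy q i) = does (i ≟ j) ∧ lookup S q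
  inCopy j S hub        = false

  spread : Fin k → Subset m → Subset (m * k + 1)
  spread j S = tabulateᵥ (inCopy j S)

  lookup-spread-copy : ∀ j S q → lookup (spread j S) (index (copy q j)) ≡ lookup S q
  lookup-spread-copy j S q =
    trans (lookup-tabulateᵥ (inCopy j S) (copy q j)) (cong (_∧ lookup S q) (dec-true (j ≟ j) refl))

  spread-injective : ∀ {j S S′} → spread j S ≡ spread j S′ → S ≡ S′
  spread-injective {j} {S} {S′} e = lookup-ext λ q → begin
    lookup S q                               ≡⟨ lookup-spread-copy j S q ⟨
    lookup (spread j S) (index (copy q j))   ≡⟨ cong (λ T → lookup T (index (copy q j))) e ⟩
    lookup (spread j S′) (index (copy q j))  ≡⟨ lookup-spread-copy j S′ q ⟩
    lookup S′ q                              ∎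
    where open ≡-Reasoning

  spread-nonempty⁺ : ∀ {j S} → Nonempty S → Nonempty (spread j S)
  spread-nonempty⁺ {j} {S} (q , q∈S) =
    index (copy q j) , lookup⇒[]= _ _ (trans (lookup-spread-copy j S q) ([]=⇒lookup q∈S))

  spread-nonempty⁻ : ∀ {j S} → Nonempty (spread j S) → Nonempty S
  spread-nonempty⁻ {j} {S} (i , i∈) =
    via-index {P = λ i → lookup (spread j S) i ≡ true → Nonempty S} from-vertex i ([]=⇒lookup i∈)
    where
    from-vertex : ∀ x → lookup (spread j S) (index x) ≡ true → Nonempty S
    from-vertex x e with x | trans (sym (lookup-tabulateᵥ (inCopy j S) x)) e
    ... | copy q l | l∈ = q , lookup⇒[]= q S (∧-conicalʳ (does (l ≟ j)) (lookup S q) l∈)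

  spread-disjoint : ∀ {i j S S′} → i ≢ j → Nonempty S → spread i S ≢ spread j S′
  spread-disjoint {i} {j} {S} {S′} i≢j (q , q∈S) e = true≢false (begin
    true                                      ≡⟨ []=⇒lookup q∈S ⟨
    lookup S q                                ≡⟨ lookup-spread-copy i S q ⟨
    lookup (spread i S) (index (copy q i))    ≡⟨ cong (λ T → lookup T (index (copy q i))) e ⟩
    lookup (spread j S′) (index (copy q i))   ≡⟨ lookup-tabulateᵥ (inCopy j S′) (copy q i) ⟩
    does (i ≟ j) ∧ lookup S′ q                ≡⟨ cong (_∧ lookup S′ q) (dec-false (i ≟ j) i≢j) ⟩
    false                                     ∎)
    where open ≡-Reasoning

  N∩-copy : ∀ C p j → index hub ∉ N[ index (copy p j) ] G ∩ C →
            N[ index (copy p j) ] G ∩ C ≡ spread j (N[ p ] H ∩ C ↾ j)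
  N∩-copy C p j hub∉ = lookup-ext (via-index pointwise)
    where
    N = N[ index (copy p j) ] G
    S = N[ p ] H ∩ C ↾ j
    pointwise : ∀ y → lookup (N ∩ C) (index y) ≡ lookup (spread j S) (index y)
    pointwise (copy q i) with i ≟ j
    ... | yes refl = begin
      lookup (N ∩ C) (index (copy q i))                          ≡⟨ lookup-∩ N C _ ⟩
      lookup N (index (copy q i)) ∧ lookup C (index (copy q i))
        ≡⟨ cong₂ _∧_ (N-same-copy p q i) (sym (lookup∘tabulate _ q)) ⟩
      lookup (N[ p ] H) q ∧ lookup (C ↾ i) q                     ≡⟨ lookup-∩ (N[ p ] H) (C ↾ i) q ⟨
      lookup S q                                                 ≡⟨ lookup-spread-copy i S q ⟨
      lookup (spread i S) (index (copy q i))                     ∎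
      where open ≡-Reasoning
    ... | no i≢j = begin
      lookup (N ∩ C) (index (copy q i))                          ≡⟨ lookup-∩ N C _ ⟩
      lookup N (index (copy q i)) ∧ lookup C (index (copy q i))  ≡⟨ cong (_∧ _) (N-other-copy p q (i≢j ∘ sym)) ⟩
      false                                                      ≡⟨ cong (_∧ lookup S q) (dec-false (i ≟ j) i≢j) ⟨
      does (i ≟ j) ∧ lookup S q                                  ≡⟨ lookup-tabulateᵥ (inCopy j S) (copy q i) ⟨
      lookup (spread j S) (index (copy q i))                     ∎
      where open ≡-Reasoning
    pointwise hub = trans (¬-not (hub∉ ∘ lookup⇒[]= _ _)) (sym (lookup-tabulateᵥ (inCopy j S) hub))

  hub-unseen : ∀ {C p} j → p ≢ root → index hub ∉ N[ index (copy p j) ] G ∩ C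
  hub-unseen {C} {p} j p≢root hub∈ = true≢false (begin
    true                                                ≡⟨ []=⇒lookup hub∈ ⟨
    lookup (N ∩ C) (index hub)                          ≡⟨ lookup-∩ N C (index hub) ⟩
    lookup N (index hub) ∧ lookup C (index hub)         ≡⟨ cong (_∧ lookup C (index hub)) (N-copy-hub p j) ⟩
    does (p ≟ root) ∧ lookup C (index hub)              ≡⟨ cong (_∧ lookup C (index hub)) (dec-false (p ≟ root) p≢root) ⟩
    false                                               ∎)
    where
    open ≡-Reasoning
    N = N[ index (copy p j) ] G

  ↾-identifiesAllBut : ∀ {C} → IsIdentifyingCode G C → ∀ j → IdentifiesAllBut H root (C ↾ j)
  ↾-identifiesAllBut {C} (dom , sep) j = dom↾ , sep↾
    where
    dom↾ : ∀ v → v ≢ root → Nonempty (N[ v ] H ∩ C ↾ j)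
    dom↾ v v≢root = spread-nonempty⁻ (subst Nonempty (N∩-copy C v j (hub-unseen j v≢root)) (dom _))
    sep↾ : ∀ u v → u ≢ root → v ≢ root → u ≢ v → N[ u ] H ∩ C ↾ j ≢ N[ v ] H ∩ C ↾ j
    sep↾ u v u≢root v≢root u≢v e =
      sep _ _ (u≢v ∘ proj₁ ∘ copy-injective ∘ index-injective (copy u j) (copy v j))
        (trans (N∩-copy C u j (hub-unseen j u≢root))
          (trans (cong (spread j) e) (sym (N∩-copy C v j (hub-unseen j v≢root)))))

  ∣C∣≡∑∣C↾j∣ : ∀ C → ∣ C ∣ ≡ ∑[ j < k ] ∣ C ↾ j ∣ + bit (lookup C (index hub))
  ∣C∣≡∑∣C↾j∣ C = begin
    ∣ C ∣
      ≡⟨ ∣p∣≡∑bit C ⟩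
    ∑[ i < m * k + 1 ] c i
      ≡⟨ ∑-splitAt (m * k) c ⟩
    ∑[ i < m * k ] c (i ↑ˡ 1) + (c (index hub) + 0)
      ≡⟨ cong₂ _+_ (∑-combine m (c ∘ (_↑ˡ 1))) (+-identityʳ _) ⟩
    ∑[ p < m ] ∑[ j < k ] c (index (copy p j)) + c (index hub)
      ≡⟨ cong (_+ c (index hub)) (∑-comm (λ p j → c (index (copy p j)))) ⟩
    ∑[ j < k ] ∑[ p < m ] c (index (copy p j)) + c (index hub)
      ≡⟨ cong (_+ c (index hub)) (sum-cong-≗ λ j → sym (count-↾ j)) ⟩
    ∑[ j < k ] ∣ C ↾ j ∣ + c (index hub) ∎
    where
    open ≡-Reasoning
    c : Fin (m * k + 1) → ℕ
    c i = bit (lookup C i)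
    count-↾ : ∀ j → ∣ C ↾ j ∣ ≡ ∑[ p < m ] c (index (copy p j))
    count-↾ j = trans (∣p∣≡∑bit (C ↾ j)) (sum-cong-≗ λ p → cong bit (lookup∘tabulate (λ p → lookup C (index (copy p j))) p))

  idCode-lower-bound : ∀ {b} → (∀ D → IdentifiesAllBut H root D → b ≤ ∣ D ∣) →
                       ∀ C → IsIdentifyingCode G C → b * k ≤ ∣ C ∣
  idCode-lower-bound {b} bound C code = begin
    b * k                                          ≡⟨ *-comm b k ⟩
    k * b                                          ≡⟨ ∑-const k b ⟨
    ∑[ j < k ] b                                   ≤⟨ ∑-mono-≤ (λ j → bound (C ↾ j) (↾-identifiesAllBut code j)) ⟩
    ∑[ j < k ] ∣ C ↾ j ∣                            ≤⟨ m≤m+n _ _ ⟩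
    ∑[ j < k ] ∣ C ↾ j ∣ + bit (lookup C (index hub)) ≡⟨ ∣C∣≡∑∣C↾j∣ C ⟨
    ∣ C ∣                                          ∎
    where open ≤-Reasoning

  onCopies : Subset m → Vertex → Bool
  onCopies D (copy p _) = lookup D p
  onCopies D hub        = false

  copies : Subset m → Subset (m * k + 1)
  copies D = tabulateᵥ (onCopies D)

  copies-↾ : ∀ D j → copies D ↾ j ≡ D
  copies-↾ D j = lookup-ext λ p → trans (lookup∘tabulate _ p) (lookup-tabulateᵥ (onCopies D) (copy p j))

  ∣copies∣ : ∀ D → ∣ copies D ∣ ≡ ∣ D ∣ * k
  ∣copies∣ D = begin
    ∣ copies D ∣
      ≡⟨ ∣C∣≡∑∣C↾j∣ (copies D) ⟩
    ∑[ j < k ] ∣ copies D ↾ j ∣ + bit (lookup (copies D) (index hub))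
      ≡⟨ cong₂ _+_ (sum-cong-≗ λ j → cong ∣_∣ (copies-↾ D j)) (cong bit (lookup-tabulateᵥ (onCopies D) hub)) ⟩
    ∑[ j < k ] ∣ D ∣ + 0     ≡⟨ +-identityʳ _ ⟩
    ∑[ j < k ] ∣ D ∣         ≡⟨ ∑-const k ∣ D ∣ ⟩
    k * ∣ D ∣                ≡⟨ *-comm k ∣ D ∣ ⟩
    ∣ D ∣ * k                ∎
    where open ≡-Reasoning

  N∩copies : ∀ D p j → N[ index (copy p j) ] G ∩ copies D ≡ spread j (N[ p ] H ∩ D)
  N∩copies D p j =
    trans (N∩-copy (copies D) p j hub∉) (cong (λ S → spread j (N[ p ] H ∩ S)) (copies-↾ D j))
    where
    hub∉ : index hub ∉ N[ index (copy p j) ] G ∩ copies D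
    hub∉ hub∈ = true≢false (trans (sym ([]=⇒lookup (proj₂ (x∈p∩q⁻ _ _ hub∈))))
                                  (lookup-tabulateᵥ (onCopies D) hub))

  copies-isIdentifyingCode : ∀ {D} → Separates H D → root ∈ D → DominatesWithout H root D →
                             Fin k → IsIdentifyingCode G (copies D)
  copies-isIdentifyingCode {D} sepH root∈D domH j₀ = via-index dom , via-index (λ x → via-index (sep x))
    where
    N∩D-nonempty : ∀ p → Nonempty (N[ p ] H ∩ D)
    N∩D-nonempty p = let (w , _ , w∈) = domH p in w , w∈

    dom : ∀ x → Nonempty (N[ index x ] G ∩ copies D)
    dom (copy p j) = subst Nonempty (sym (N∩copies D p j)) (spread-nonempty⁺ (N∩D-nonempty p))
    dom hub = index (copy root j₀) , x∈p∩q⁺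
      ( lookup⇒[]= _ _ (trans (N-hub-copy root j₀) (dec-true (root ≟ root) refl))
      , lookup⇒[]= _ _ (trans (lookup-tabulateᵥ (onCopies D) (copy root j₀)) ([]=⇒lookup root∈D)) )

    -- a code neighbour of p other than the root is not seen from the hub
    hub-differs : ∀ p j → N[ index (copy p j) ] G ∩ copies D ≢ N[ index hub ] G ∩ copies D
    hub-differs p j e with domH p
    ... | w , w≢root , w∈ = true≢false (begin
      true                                                       ≡⟨ []=⇒lookup w∈ ⟨
      lookup (N[ p ] H ∩ D) w                                    ≡⟨ lookup-spread-copy j _ w ⟨
      lookup (spread j (N[ p ] H ∩ D)) (index (copy w j))        ≡⟨ cong (λ T → lookup T (index (copy w j))) (N∩copies D p j) ⟨
      lookup (N[ index (copy p j) ] G ∩ copies D) (index (copy w j)) ≡⟨ cong (λ T → lookup T (index (copy w j))) e ⟩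
      lookup (N[ index hub ] G ∩ copies D) (index (copy w j))    ≡⟨ lookup-∩ (N[ index hub ] G) (copies D) _ ⟩
      lookup (N[ index hub ] G) (index (copy w j)) ∧ c           ≡⟨ cong (_∧ c) (N-hub-copy w j) ⟩
      does (w ≟ root) ∧ c                                        ≡⟨ cong (_∧ c) (dec-false (w ≟ root) w≢root) ⟩
      false                                                      ∎)
      where
      open ≡-Reasoning
      c = lookup (copies D) (index (copy w j))

    sep : ∀ x y → index x ≢ index y → N[ index x ] G ∩ copies D ≢ N[ index y ] G ∩ copies D
    sep (copy p i) (copy q j) x≢y e with i ≟ j
    ... | yes refl = sepH p q (λ { refl → x≢y refl })
      (spread-injective (trans (sym (N∩copies D p i)) (trans e (N∩copies D q i))))
    ... | no i≢j = spread-disjoint i≢j (N∩D-nonempty p)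
      (trans (sym (N∩copies D p i)) (trans e (N∩copies D q j)))
    sep (copy p i) hub        _   e = hub-differs p i e
    sep hub        (copy q j) _   e = hub-differs q j (sym e)
    sep hub        hub        x≢y _ = x≢y refl

childOf : Fin 8 → Fin 8 → Bool
childOf 0F 1F = true
childOf 0F 2F = true
childOf 0F 3F = true
childOf 1F 4F = true
childOf 2F 5F = true
childOf 3F 6F = true
childOf 3F 7F = true
childOf _  _  = false

gadget : Graph 8
gadget = record
  { adj     = λ p q → childOf p q ∨ childOf q p
  ; adj-sym = λ p q → ∨-comm (childOf p q) (childOf q p)
  ; adj-irr = λ { 0F → refl ; 1F → refl ; 2F → refl ; 3F → refl ; 4F → refl ; 5F → refl ; 6F → refl ; 7F → refl }
  }

gadget-connected : Connected gadget
gadget-connected = connected-if-all-reach 0F λ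
  { 0F → here
  ; 1F → there refl here
  ; 2F → there refl here
  ; 3F → there refl here
  ; 4F → there {w = 1F} refl (there refl here)
  ; 5F → there {w = 2F} refl (there refl here)
  ; 6F → there {w = 3F} refl (there refl here)
  ; 7F → there {w = 3F} refl (there refl here)
  }

code₀ : Subset 8
code₀ = inside ∷ inside ∷ inside ∷ inside ∷ outside ∷ outside ∷ inside ∷ outside ∷ []

code₀-separates : Separates gadget code₀
code₀-separates = toWitness {a? = separates? gadget code₀} _

code₀-dominatesWithout-root : DominatesWithout gadget 0F code₀
code₀-dominatesWithout-root = toWitness {a? = dominatesWithout? gadget 0F code₀} _

-- N[1] and N[4] differ only in the vertex 0.
root-in-code : ∀ D → IdentifiesAllBut gadget 0F D → lookup D 0F ≡ true
root-in-code (true  ∷ _) _ = refl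
root-in-code (false ∷ _ ∷ _ ∷ _ ∷ _ ∷ _ ∷ _ ∷ _ ∷ []) (_ , sep) = ⊥-elim (sep 1F 4F (λ ()) (λ ()) (λ ()) refl)

leaf₄-dominated : ∀ D → IdentifiesAllBut gadget 0F D → lookup D 1F ∨ lookup D 4F ≡ true
leaf₄-dominated (_ ∷ true  ∷ _) _ = refl
leaf₄-dominated (_ ∷ false ∷ _ ∷ _ ∷ true  ∷ _) _ = refl
leaf₄-dominated (_ ∷ false ∷ _ ∷ _ ∷ false ∷ _ ∷ _ ∷ _ ∷ []) (dom , _) = ⊥-elim (∉⊥ (proj₂ (dom 4F λ ())))

leaf₅-dominated : ∀ D → IdentifiesAllBut gadget 0F D → lookup D 2F ∨ lookup D 5F ≡ true
leaf₅-dominated (_ ∷ _ ∷ true  ∷ _) _ = refl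
leaf₅-dominated (_ ∷ _ ∷ false ∷ _ ∷ _ ∷ true  ∷ _) _ = refl
leaf₅-dominated (_ ∷ _ ∷ false ∷ _ ∷ _ ∷ false ∷ _ ∷ _ ∷ []) (dom , _) = ⊥-elim (∉⊥ (proj₂ (dom 5F λ ())))

leaf₆-dominated : ∀ D → IdentifiesAllBut gadget 0F D → lookup D 3F ∨ lookup D 6F ≡ true
leaf₆-dominated (_ ∷ _ ∷ _ ∷ true  ∷ _) _ = refl
leaf₆-dominated (_ ∷ _ ∷ _ ∷ false ∷ _ ∷ _ ∷ true  ∷ _) _ = refl
leaf₆-dominated (_ ∷ _ ∷ _ ∷ false ∷ _ ∷ _ ∷ false ∷ _ ∷ []) (dom , _) = ⊥-elim (∉⊥ (proj₂ (dom 6F λ ())))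

leaf₇-dominated : ∀ D → IdentifiesAllBut gadget 0F D → lookup D 3F ∨ lookup D 7F ≡ true
leaf₇-dominated (_ ∷ _ ∷ _ ∷ true  ∷ _) _ = refl
leaf₇-dominated (_ ∷ _ ∷ _ ∷ false ∷ _ ∷ _ ∷ _ ∷ true  ∷ []) _ = refl
leaf₇-dominated (_ ∷ _ ∷ _ ∷ false ∷ _ ∷ _ ∷ _ ∷ false ∷ []) (dom , _) = ⊥-elim (∉⊥ (proj₂ (dom 7F λ ())))

-- N[6] = {3, 6} and N[7] = {3, 7}.
twins-separated : ∀ D → IdentifiesAllBut gadget 0F D → lookup D 6F ∨ lookup D 7F ≡ true
twins-separated (_ ∷ _ ∷ _ ∷ _ ∷ _ ∷ _ ∷ true  ∷ _) _ = refl
twins-separated (_ ∷ _ ∷ _ ∷ _ ∷ _ ∷ _ ∷ false ∷ true  ∷ []) _ = refl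
twins-separated (_ ∷ _ ∷ _ ∷ _ ∷ _ ∷ _ ∷ false ∷ false ∷ []) (_ , sep) = ⊥-elim (sep 6F 7F (λ ()) (λ ()) (λ ()) refl)

gadget-lower-bound : ∀ D → IdentifiesAllBut gadget 0F D → 5 ≤ ∣ D ∣
gadget-lower-bound D@(d₀ ∷ d₁ ∷ d₂ ∷ d₃ ∷ d₄ ∷ d₅ ∷ d₆ ∷ d₇ ∷ []) ident = begin
  1 + (1 + (1 + 2))
    ≤⟨ +-mono-≤ (≤-reflexive (cong bit (sym (root-in-code D ident))))
       (+-mono-≤ (1≤bit+bit d₁ d₄ (leaf₄-dominated D ident))
       (+-mono-≤ (1≤bit+bit d₂ d₅ (leaf₅-dominated D ident))
                 (2≤bit+bit+bit d₃ d₆ d₇ (leaf₆-dominated D ident) (leaf₇-dominated D ident) (twins-separated D ident)))) ⟩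
  bit d₀ + ((bit d₁ + bit d₄) + ((bit d₂ + bit d₅) + (bit d₃ + bit d₆ + bit d₇)))
    ≡⟨ solve 8 (λ a₀ a₁ a₂ a₃ a₄ a₅ a₆ a₇ →
         a₀ :+ ((a₁ :+ a₄) :+ ((a₂ :+ a₅) :+ (a₃ :+ a₆ :+ a₇)))
         := a₀ :+ (a₁ :+ (a₂ :+ (a₃ :+ (a₄ :+ (a₅ :+ (a₆ :+ (a₇ :+ con 0))))))))
         refl (bit d₀) (bit d₁) (bit d₂) (bit d₃) (bit d₄) (bit d₅) (bit d₆) (bit d₇) ⟩
  ∑[ i < 8 ] bit (lookup D i)
    ≡⟨ ∣p∣≡∑bit D ⟨
  ∣ D ∣ ∎
  where
  open ≤-Reasoning
  open +-*-Solver

proposition12 : (k : ℕ) → 1 ≤ k →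
    Σ (Graph (8 * k + 1)) (λ G → Connected G × IdCodeNumber G (5 * k))
proposition12 k@(suc _) _ =
  hubOfCopies , hubOfCopies-connected gadget-connected ,
  (copies code₀ , copies-code₀ , ∣copies∣ code₀) , idCode-lower-bound gadget-lower-bound
  where
  open HubOfCopies gadget 0F k
  copies-code₀ : IsIdentifyingCode hubOfCopies (copies code₀)
  copies-code₀ = copies-isIdentifyingCode code₀-separates (lookup⇒[]= 0F code₀ refl) code₀-dominatesWithout-root 0F
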